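{- Let $A=\{(n_0,\dots,n_7)\mid n_0=n_2=n_4=n_6=n_1+n_3+n_5+n_7\}$, $B=\{(n_0,\dots,n_7)\mid n_0=n_2=n_4=n_6 \text{ and } n_1=n_3=n_5=n_7\}$, and $P=(A\setminus B)\cup\{(0,0,0,0,0,0,0,0)\}$. A position $M=(n_0,\dots,n_7)$ of ${\rm ECN}(8_{\{1,2,3\}},6)$ is a $\mathcal{P}$-position if and only if $M\in_\circlearrowleft P$.
   Context: Extended circular nim ${\rm ECN}(m_S,k)$ (positive integers $k\le m$, $S$ a set of positive integers each at most $m/2$): there are $m$ piles $v_0,\dots,v_{m-1}$ arranged in a circle (indices mod $m$); a position is a tuple $(n_0,\dots,n_{m-1})$ of nonnegative integers, $n_i$ being the number of tokens on $v_i$. A move chooses $s\in S$, $i\in\{0,\dots,m-1\}$, $j\in\{0,\dots,k-1\}$ and removes an arbitrary nonnegative number of tokens from each pile $v_{(i+ts)\bmod m}$, $t=0,\dots,j$, removing at least one token in total (empty piles still count as piles). Normal play: the player unable to move loses. A $\mathcal{P}$-position is a position from which the previous player (the player who just moved) has a winning strategy. For a set $P$ of $m$-tuples and $M=(n_0,\dots,n_{m-1})$, $M\in_\circlearrowleft P$ means there exists $i<m$ such that $(n_i,n_{(i+1)\bmod m},\dots,n_{(i+m-1)\bmod m})\in P$ or $(n_i,n_{(i+m-1)\bmod m},\dots,n_{(i+1)\bmod m})\in P$. -}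

module Defs where

open import Data.Nat using (ℕ; zero; suc; _+_; _*_; _∸_; _≤_; _<_; NonZero)
open import Data.Nat.DivMod using (_%_; m%n<n)
open import Data.Fin using (Fin; toℕ; fromℕ<)
open import Data.List using (List; _∷_; [])
open import Data.List.Membership.Propositional using (_∈_)
open import Data.Product using (Σ; ∃; _×_; _,_)
open import Data.Sum using (_⊎_)
open import Relation.Nullary using (¬_)
open import Relation.Binary.PropositionalEquality using (_≡_)

Position : ℕ → Set
Position m = Fin m → ℕ

pileIdx : (m : ℕ) .{{_ : NonZero m}} → ℕ → Fin m
pileIdx m n = fromℕ< (m%n<n n m)

Affected : (m : ℕ) .{{_ : NonZero m}} → ℕ → Fin m → ℕ → Fin m → Set
Affected m s i j p = Σ ℕ λ t → t ≤ j × pileIdx m (toℕ i + t * s) ≡ p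

ECNMove : (m : ℕ) .{{_ : NonZero m}} → List ℕ → ℕ → Position m → Position m → Set
ECNMove m S k M M' =
  Σ ℕ λ s → s ∈ S × Σ (Fin m) λ i → Σ ℕ λ j → j < k ×
    ((∀ p → M' p ≤ M p)
    × (∀ p → ¬ Affected m s i j p → M' p ≡ M p)
    × Σ (Fin m) (λ p → M' p < M p))

-- Normal-play outcome classes (inductively: existence of winning strategies;
-- the game is finite, so this is the usual P/N classification).
module Outcome {Pos : Set} (Move : Pos → Pos → Set) where
  data Win : Pos → Set
  data Lose : Pos → Set
  data Win where
    win : ∀ {M} M' → Move M M' → Lose M' → Win M
  data Lose where
    lose : ∀ {M} → (∀ M' → Move M M' → Win M') → Lose M

IsPPosition : (m : ℕ) .{{_ : NonZero m}} → List ℕ → ℕ → Position m → Set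
IsPPosition m S k = Outcome.Lose (ECNMove m S k)

_∈↻_ : {m : ℕ} .{{_ : NonZero m}} → Position m → (Position m → Set) → Set
_∈↻_ {m} M P = Σ (Fin m) λ i →
    P (λ r → M (pileIdx m (toℕ i + toℕ r)))
  ⊎ P (λ r → M (pileIdx m (toℕ i + (m ∸ toℕ r))))

module Eight (n : Position 8) where
  open import Data.Fin using (zero; suc)
  n0 = n zero
  n1 = n (suc zero)
  n2 = n (suc (suc zero))
  n3 = n (suc (suc (suc zero)))
  n4 = n (suc (suc (suc (suc zero))))
  n5 = n (suc (suc (suc (suc (suc zero)))))
  n6 = n (suc (suc (suc (suc (suc (suc zero))))))
  n7 = n (suc (suc (suc (suc (suc (suc (suc zero)))))))

SetA : Position 8 → Set
SetA n = n0 ≡ n2 × n2 ≡ n4 × n4 ≡ n6 × n6 ≡ n1 + n3 + n5 + n7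
  where open Eight n

SetB : Position 8 → Set
SetB n = (n0 ≡ n2 × n2 ≡ n4 × n4 ≡ n6) × (n1 ≡ n3 × n3 ≡ n5 × n5 ≡ n7)
  where open Eight n

SetP : Position 8 → Set
SetP n = (SetA n × ¬ SetB n) ⊎ (∀ p → n p ≡ 0)

{-# OPTIONS --safe #-}
-- Write X for the even piles and Y for the odd piles. A move with s = 2 lowers piles of one
-- parity class only, while s = 1 and s = 3 leave at least one even and one odd pile untouched;
-- conversely every such lowering of (X, Y) is a single move. The P-positions form the kernel of
-- this move relation: X constant v with Σ Y = v and Y non-constant unless v = 0, or the same with
-- X and Y exchanged. No move joins two kernel positions (an untouched entry or the untouched sum
-- pins v, and then nothing can drop), and every other position reaches one by lowering the class
-- of larger minimum to a constant and the other class, keeping its smallest entry, to that total.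
-- Rotations and reflections of the circle map parity classes onto parity classes, which turns
-- M ∈↻ P into the kernel condition.

module Submission where

open import Defs
open import Data.Nat using (ℕ; zero; suc; _+_; _*_; _∸_; _≤_; _<_; _⊓_; z≤n; s≤s; s≤s⁻¹)
open import Data.Nat.Properties
open import Data.Nat.Induction using (<-wellFounded)
open import Data.Nat.Tactic.RingSolver using (solve-∀)
open import Data.Fin using (Fin; toℕ; punchIn) renaming (suc to fsuc)
open import Data.Fin.Patterns using (0F; 1F; 2F; 3F; 4F; 5F; 6F; 7F)
open import Data.Fin.Permutation using (Permutation; _⟨$⟩ʳ_; _⟨$⟩ˡ_; _∘ₚ_; inverseʳ; transpose; reverse)
import Data.Fin.Permutation as Perm
open import Data.Fin.Properties using (¬∀⟶∃¬; all?; any?) renaming (_≟_ to _≟ᶠ_)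
open import Data.Vec.Functional using (insertAt; removeAt)
open import Data.Vec.Functional.Properties using (insertAt-lookup; removeAt-insertAt; insertAt-removeAt)
open import Algebra.Properties.CommutativeMonoid.Sum +-0-commutativeMonoid using (sum; sum-remove; sum-cong-≗; sum-permute)
open import Data.List using (List; _∷_; [])
open import Data.List.Membership.Propositional using (_∈_; find)
open import Data.List.Relation.Unary.Any using (Any; here; there; satisfied)
import Data.List.Relation.Unary.Any as Any
import Data.List.Relation.Unary.All as All
open import Data.Product using (∃-syntax; _×_; _,_; proj₁; proj₂)
open import Data.Sum using (_⊎_; inj₁; inj₂; [_,_]′; swap)
open import Data.Empty using (⊥-elim)
open import Data.Unit using (tt)
open import Function using (id; _∘_; flip; _⇔_; mk⇔)
open import Function.Properties.Equivalence using () renaming (trans to ⇔-trans)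
open import Induction.WellFounded using (WellFounded; Acc; acc; module Subrelation)
import Relation.Binary.Construct.On as On
open import Relation.Nullary using (¬_; Dec; yes; no; ¬?; contradiction)
open import Relation.Nullary.Decidable using (map′; toWitness; _×-dec_; _⊎-dec_; _→-dec_)
open import Relation.Binary.PropositionalEquality

-- Kernels of well-founded games

module KernelCharacterisation {Pos : Set} (Move : Pos → Pos → Set) where
  open Outcome Move

  win⇒¬lose : ∀ {M} → Win M → ¬ Lose M
  win⇒¬lose (win M' mv l) (lose f) = win⇒¬lose (f M' mv) l

  module _ {K : Pos → Set}
           (wf : WellFounded (flip Move))
           (stable : ∀ {M M'} → Move M M' → K M → ¬ K M')
           (absorbing : ∀ M → K M ⊎ ∃[ M' ] Move M M' × K M') where

    kernel⇒lose : ∀ {M} → K M → Lose M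
    kernel⇒lose {M} = go (wf M)
      where
      go : ∀ {M} → Acc (flip Move) M → K M → Lose M
      go {M} (acc rs) k = lose λ M' mv → reply mv (rs mv) (absorbing M')
        where
        reply : ∀ {M'} → Move M M' → Acc (flip Move) M' → K M' ⊎ ∃[ M'' ] Move M' M'' × K M'' → Win M'
        reply mv _         (inj₁ k')                 = ⊥-elim (stable mv k k')
        reply _  (acc rs′) (inj₂ (M'' , mv' , k'')) = win M'' mv' (go (rs′ mv') k'')

    lose⇒kernel : ∀ {M} → Lose M → K M
    lose⇒kernel {M} (lose f) with absorbing M
    ... | inj₁ k               = k
    ... | inj₂ (M' , mv , k') = ⊥-elim (win⇒¬lose (f M' mv) (kernel⇒lose k'))

    lose⇔kernel : ∀ M → Lose M ⇔ K M
    lose⇔kernel M = mk⇔ lose⇒kernel kernel⇒lose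

Tuple : ℕ → Set
Tuple n = Fin n → ℕ

module _ {n : ℕ} where

  infix 4 _≤*_

  _≤*_ : Tuple n → Tuple n → Set
  X ≤* Y = ∀ k → X k ≤ Y k

  Drops : Tuple n → Tuple n → Set
  Drops X' X = ∃[ k ] X' k < X k

  SomeEqual : Tuple n → Tuple n → Set
  SomeEqual X' X = ∃[ k ] X' k ≡ X k

  Constant : ℕ → Tuple n → Set
  Constant v X = ∀ k → X k ≡ v

  IsConstant : Tuple n → Set
  IsConstant X = ∃[ v ] Constant v X

  constant? : ∀ v X → Dec (Constant v X)
  constant? v X = all? (λ k → X k ≟ v)

sum-mono-≤ : ∀ {n} {X Y : Tuple n} → X ≤* Y → sum X ≤ sum Y
sum-mono-≤ {zero}  _   = z≤n
sum-mono-≤ {suc n} X≤Y = +-mono-≤ (X≤Y 0F) (sum-mono-≤ (X≤Y ∘ fsuc))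

sum-mono-< : ∀ {n} {X Y : Tuple n} → X ≤* Y → Drops X Y → sum X < sum Y
sum-mono-< {suc n} X≤Y (0F     , lt) = +-mono-<-≤ lt (sum-mono-≤ (X≤Y ∘ fsuc))
sum-mono-< {suc n} X≤Y (fsuc k , lt) = +-mono-≤-< (X≤Y 0F) (sum-mono-< (X≤Y ∘ fsuc) (k , lt))

lookup≤sum : ∀ {n} (X : Tuple n) k → X k ≤ sum X
lookup≤sum X 0F       = m≤m+n (X 0F) _
lookup≤sum X (fsuc k) = ≤-trans (lookup≤sum (X ∘ fsuc) k) (m≤n+m _ (X 0F))

sum≡0⇒≡0 : ∀ {n} {X : Tuple n} → sum X ≡ 0 → Constant 0 X
sum≡0⇒≡0 {X = X} s≡0 k = n≤0⇒n≡0 (subst (X k ≤_) s≡0 (lookup≤sum X k))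

sum-constant : ∀ {n v} {X : Tuple n} → Constant v X → sum X ≡ n * v
sum-constant {zero}  _ = refl
sum-constant {suc n} c = cong₂ _+_ (c 0F) (sum-constant (c ∘ fsuc))

sum-zero : ∀ {n} {X : Tuple n} → Constant 0 X → sum X ≡ 0
sum-zero {n} c = trans (sum-constant c) (*-zeroʳ n)

drops-of-sum< : ∀ {n} {X Y : Tuple n} → X ≤* Y → sum X < sum Y → Drops X Y
drops-of-sum< {X = X} {Y} X≤Y s< with any? (λ k → X k <? Y k)
... | yes d = d
... | no ¬d = contradiction (sum-cong-≗ X≗Y) (<⇒≢ s<)
  where
  X≗Y : ∀ k → X k ≡ Y k
  X≗Y k = ≤-antisym (X≤Y k) (≮⇒≥ (¬d ∘ (k ,_)))

sum-insertAt : ∀ {n} (W : Tuple n) j v → sum (insertAt W j v) ≡ v + sum W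
sum-insertAt W j v = begin
  sum (insertAt W j v)                                 ≡⟨ sum-remove (insertAt W j v) ⟩
  insertAt W j v j + sum (removeAt (insertAt W j v) j)  ≡⟨ cong₂ _+_ (insertAt-lookup W j v)
                                                                     (sum-cong-≗ (removeAt-insertAt W j v)) ⟩
  v + sum W                                             ∎
  where open ≡-Reasoning

insertAt-mono : ∀ {n} {W W' : Tuple n} j {v v'} → W ≤* W' → v ≤ v' → insertAt W j v ≤* insertAt W' j v'
insertAt-mono 0F                W≤W' v≤v' 0F       = v≤v'
insertAt-mono 0F                W≤W' v≤v' (fsuc k) = W≤W' k
insertAt-mono {suc n} (fsuc j) W≤W' v≤v' 0F       = W≤W' 0F
insertAt-mono {suc n} (fsuc j) W≤W' v≤v' (fsuc k) = insertAt-mono j (W≤W' ∘ fsuc) v≤v' k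

insertAt-constant : ∀ {n v} {W : Tuple n} j → Constant v W → Constant v (insertAt W j v)
insertAt-constant 0F                c 0F       = refl
insertAt-constant 0F                c (fsuc k) = c k
insertAt-constant {suc n} (fsuc j) c 0F       = c 0F
insertAt-constant {suc n} (fsuc j) c (fsuc k) = insertAt-constant j (c ∘ fsuc) k

m≤n+o⇒m∸[n⊓m]≤o : ∀ {m} n {o} → m ≤ n + o → m ∸ (n ⊓ m) ≤ o
m≤n+o⇒m∸[n⊓m]≤o {m} n m≤n+o with m ≤? n
... | yes m≤n = subst (λ x → m ∸ x ≤ _) (sym (m≥n⇒m⊓n≡n m≤n))
                    (≤-trans (≤-reflexive (n∸n≡0 m)) z≤n)
... | no  m≰n = subst (λ x → m ∸ x ≤ _) (sym (m≤n⇒m⊓n≡m (<⇒≤ (≰⇒> m≰n))))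
                    (m≤n+o⇒m∸n≤o m n m≤n+o)

interpolate : ∀ {n} (U : Tuple n) {R} → R ≤ sum U → ∃[ Z ] Z ≤* U × sum Z ≡ R
interpolate-at : ∀ {n} (U : Tuple (suc n)) j {R} → R ≤ sum U →
                 ∃[ Z ] Z ≤* U × sum Z ≡ R × Z j ≡ U j ⊓ R

interpolate {zero}  U R≤0 = (λ ()) , (λ ()) , sym (n≤0⇒n≡0 R≤0)
interpolate {suc n} U R≤  with interpolate-at U 0F R≤
... | Z , Z≤U , sZ , _ = Z , Z≤U , sZ

interpolate-at {n} U j {R} R≤
  with interpolate (removeAt U j) (m≤n+o⇒m∸[n⊓m]≤o (U j) (subst (R ≤_) (sum-remove U) R≤))
... | W , W≤ , sW = Z , Z≤U , sZ , insertAt-lookup W j (U j ⊓ R)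
  where
  Z : Tuple (suc n)
  Z = insertAt W j (U j ⊓ R)
  Z≤U : Z ≤* U
  Z≤U k = subst (Z k ≤_) (insertAt-removeAt U j k) (insertAt-mono j W≤ (m⊓n≤m (U j) R) k)
  sZ : sum Z ≡ R
  sZ = begin
    sum Z                      ≡⟨ sum-insertAt W j (U j ⊓ R) ⟩
    U j ⊓ R + sum W            ≡⟨ cong (U j ⊓ R +_) sW ⟩
    U j ⊓ R + (R ∸ U j ⊓ R)    ≡⟨ m+[n∸m]≡n (m⊓n≤n (U j) R) ⟩
    R                          ∎
    where open ≡-Reasoning

-- Putting as much as possible on a coordinate j where U differs from c makes Z differ from c
-- there too, unless that coordinate swallows all of R, which forces everything else to 0.
interpolate-avoiding : ∀ {n c R} (U : Tuple (suc (suc n))) → ¬ Constant c U → R ≤ sum U →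
                ∃[ Z ] Z ≤* U × sum Z ≡ R × (¬ Constant c Z ⊎ c + R ≡ 0)
interpolate-avoiding {c = c} {R} U ¬cU R≤ with ¬∀⟶∃¬ _ _ (λ k → U k ≟ c) ¬cU
... | j , Uj≢c with interpolate-at U j R≤
... | Z , Z≤U , sZ , Zj = Z , Z≤U , sZ , avoid
  where
  avoid : ¬ Constant c Z ⊎ c + R ≡ 0
  avoid with constant? c Z | U j ≤? R
  ... | no ¬cZ | _       = inj₁ ¬cZ
  ... | yes cZ | yes Uj≤R = contradiction (trans (sym (m≤n⇒m⊓n≡m Uj≤R)) (trans (sym Zj) (cZ j))) Uj≢c
  ... | yes cZ | no  Uj≰R = inj₂ (cong₂ _+_ c≡0 (trans (sym c≡R) c≡0))
    where
    c≡R : c ≡ R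
    c≡R = trans (sym (cZ j)) (trans Zj (m≥n⇒m⊓n≡n (<⇒≤ (≰⇒> Uj≰R))))
    rest≡0 : sum (removeAt Z j) ≡ 0
    rest≡0 = +-cancelˡ-≡ R _ 0 (begin
      R + sum (removeAt Z j)   ≡⟨ cong (_+ _) (trans (sym c≡R) (sym (cZ j))) ⟩
      Z j + sum (removeAt Z j) ≡⟨ sum-remove Z ⟨
      sum Z                    ≡⟨ sZ ⟩
      R                        ≡⟨ +-identityʳ R ⟨
      R + 0                    ∎)
      where open ≡-Reasoning
    c≡0 : c ≡ 0
    c≡0 = trans (sym (cZ (punchIn j 0F))) (sum≡0⇒≡0 {X = removeAt Z j} rest≡0 0F)

interpolate-nonconstant : ∀ {n T} (Y : Tuple (3 + n)) k → ¬ IsConstant Y → Y k ≤ T → T ≤ sum Y →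
       ∃[ Y' ] Y' ≤* Y × Y' k ≡ Y k × sum Y' ≡ T × (¬ IsConstant Y' ⊎ T ≡ 0)
interpolate-nonconstant {n} {T} Y k ¬cY Yk≤T T≤
  with interpolate-avoiding (removeAt Y k) ¬c-rest (m≤n+o⇒m∸n≤o T (Y k) (subst (T ≤_) (sum-remove Y) T≤))
  where
  ¬c-rest : ¬ Constant (Y k) (removeAt Y k)
  ¬c-rest c = ¬cY (Y k , λ i → trans (sym (insertAt-removeAt Y k i)) (insertAt-constant k c i))
... | Z , Z≤ , sZ , avoid = Y' , Y'≤Y , insertAt-lookup Z k (Y k) , sY' , nonconstant
  where
  Y' : Tuple (3 + n)
  Y' = insertAt Z k (Y k)
  Y'≤Y : Y' ≤* Y
  Y'≤Y i = subst (Y' i ≤_) (insertAt-removeAt Y k i) (insertAt-mono k Z≤ ≤-refl i)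
  sY' : sum Y' ≡ T
  sY' = trans (sum-insertAt Z k (Y k)) (trans (cong (Y k +_) sZ) (m+[n∸m]≡n Yk≤T))
  rest-constant : IsConstant Y' → Constant (Y k) Z
  rest-constant (c , cY') i = begin
    Z i                  ≡⟨ removeAt-insertAt Z k (Y k) i ⟨
    Y' (punchIn k i)     ≡⟨ cY' (punchIn k i) ⟩
    c                    ≡⟨ cY' k ⟨
    Y' k                 ≡⟨ insertAt-lookup Z k (Y k) ⟩
    Y k                  ∎
    where open ≡-Reasoning
  nonconstant : ¬ IsConstant Y' ⊎ T ≡ 0
  nonconstant = [ (λ ¬cZ → inj₁ (¬cZ ∘ rest-constant))
                , (λ e → inj₂ (trans (sym (m+[n∸m]≡n Yk≤T)) e)) ]′ avoid

drops-to-constant : ∀ {n v} {X : Tuple n} → (∀ k → v ≤ X k) → ¬ Constant v X → Drops (λ _ → v) X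
drops-to-constant {v = v} {X} v≤X ¬cX with ¬∀⟶∃¬ _ _ (λ k → X k ≟ v) ¬cX
... | k , Xk≢v = k , ≤∧≢⇒< (v≤X k) (Xk≢v ∘ sym)

isConstant? : ∀ {n} (X : Tuple (suc n)) → Dec (IsConstant X)
isConstant? X = map′ (X 0F ,_) (λ (v , c) k → trans (c k) (sym (c 0F))) (constant? (X 0F) X)

argmin : ∀ {n} (X : Tuple (suc n)) → ∃[ k ] ∀ i → X k ≤ X i
argmin {zero}  X = 0F , λ { 0F → ≤-refl }
argmin {suc n} X with argmin (X ∘ fsuc)
... | k , min with X 0F ≤? X (fsuc k)
...   | yes le = 0F     , λ { 0F → ≤-refl ; (fsuc i) → ≤-trans le (min i) }
...   | no  gt = fsuc k , λ { 0F → <⇒≤ (≰⇒> gt) ; (fsuc i) → min i }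

-- The game on a pair of tuples

module _ {n : ℕ} where

  data Keeps (X Y X' Y' : Tuple n) : Set where
    keeps-X        : (∀ k → X' k ≡ X k) → Keeps X Y X' Y'
    keeps-Y        : (∀ k → Y' k ≡ Y k) → Keeps X Y X' Y'
    keeps-one-each : SomeEqual X' X → SomeEqual Y' Y → Keeps X Y X' Y'

  record Step (X Y X' Y' : Tuple n) : Set where
    constructor step
    field
      X'≤X  : X' ≤* X
      Y'≤Y  : Y' ≤* Y
      drops : Drops X' X ⊎ Drops Y' Y
      keeps : Keeps X Y X' Y'

  Balanced : Tuple n → Tuple n → Set
  Balanced X Y = ∃[ v ] Constant v X × sum Y ≡ v × (¬ IsConstant Y ⊎ v ≡ 0)

  Kernel : Tuple n → Tuple n → Set
  Kernel X Y = Balanced X Y ⊎ Balanced Y X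

  Absorbed : Tuple n → Tuple n → Set
  Absorbed X Y = Kernel X Y ⊎ ∃[ X' ] ∃[ Y' ] Step X Y X' Y' × Kernel X' Y'

  step-swap : ∀ {X Y X' Y'} → Step X Y X' Y' → Step Y X Y' X'
  step-swap (step X'≤X Y'≤Y drops keeps) = step Y'≤Y X'≤X (swap drops) (keeps-swap keeps)
    where
    keeps-swap : ∀ {X Y X' Y'} → Keeps X Y X' Y' → Keeps Y X Y' X'
    keeps-swap (keeps-X e)             = keeps-Y e
    keeps-swap (keeps-Y e)             = keeps-X e
    keeps-swap (keeps-one-each ex ey) = keeps-one-each ey ex

  absorbed-swap : ∀ {X Y} → Absorbed Y X → Absorbed X Y
  absorbed-swap (inj₁ k)                  = inj₁ (swap k)
  absorbed-swap (inj₂ (Y' , X' , s , k)) = inj₂ (X' , Y' , step-swap s , swap k)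

  no-step-from-zero : ∀ {X Y X' Y'} → Constant 0 X → sum Y ≡ 0 → ¬ Step X Y X' Y'
  no-step-from-zero cX _  (step _ _ (inj₁ (k , lt)) _) = n≮0 (subst (_ <_) (cX k) lt)
  no-step-from-zero _  sY (step _ _ (inj₂ (k , lt)) _) = n≮0 (subst (_ <_) (sum≡0⇒≡0 sY k) lt)

keeps-Y-or-some-X : ∀ {n} {X Y X' Y' : Tuple (suc n)} → Keeps X Y X' Y' → (∀ k → Y' k ≡ Y k) ⊎ SomeEqual X' X
keeps-Y-or-some-X (keeps-X e)            = inj₂ (0F , e 0F)
keeps-Y-or-some-X (keeps-Y e)            = inj₁ e
keeps-Y-or-some-X (keeps-one-each ex _) = inj₂ ex

balanced-step-¬balanced : ∀ {n} {X Y X' Y' : Tuple (suc n)} →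
                          Balanced X Y → Step X Y X' Y' → ¬ Balanced X' Y'
balanced-step-¬balanced (v , cX , sY , _) (step _ Y'≤Y drops keeps) (v' , cX' , sY' , _) =
  [ (λ (k , lt) → <-irrefl (trans (cX' k) (trans v'≡v (sym (cX k)))) lt)
  , (λ d → <-irrefl (trans sY' (trans v'≡v (sym sY))) (sum-mono-< Y'≤Y d)) ]′ drops
  where
  v'≡v : v' ≡ v
  v'≡v = [ (λ Y'≗Y → trans (sym sY') (trans (sum-cong-≗ Y'≗Y) sY))
         , (λ (k , e) → trans (sym (cX' k)) (trans e (cX k))) ]′ (keeps-Y-or-some-X keeps)

-- A kept X-entry gives v ≤ w, while Y' being constant w gives (2 + n) w ≤ v.
balanced-step-¬balanced-swap : ∀ {n} {X Y X' Y' : Tuple (2 + n)} →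
                               Balanced X Y → Step X Y X' Y' → ¬ Balanced Y' X'
balanced-step-¬balanced-swap {n} {Y = Y} {X'} {Y'} (v , cX , sY , ncY) s@(step _ Y'≤Y _ keeps) (w , cY' , sX' , _) =
  no-step-from-zero (λ k → trans (cX k) v≡0) (trans sY v≡0) s
  where
  v≡0 : v ≡ 0
  v≡0 with keeps-Y-or-some-X keeps
  ... | inj₁ Y'≗Y     = [ (λ ¬cY → contradiction (w , λ k → trans (sym (Y'≗Y k)) (cY' k)) ¬cY) , id ]′ ncY
  ... | inj₂ (k , e) = n≤0⇒n≡0 (subst (v ≤_) w≡0 v≤w)
    where
    v≤w : v ≤ w
    v≤w = begin
      v       ≡⟨ trans (sym (cX k)) (sym e) ⟩
      X' k    ≤⟨ lookup≤sum X' k ⟩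
      sum X'  ≡⟨ sX' ⟩
      w       ∎
      where open ≤-Reasoning
    [2+n]w≤w : w + (w + n * w) ≤ w + 0
    [2+n]w≤w = begin
      w + (w + n * w)  ≡⟨ sum-constant cY' ⟨
      sum Y'           ≤⟨ sum-mono-≤ Y'≤Y ⟩
      sum Y            ≡⟨ sY ⟩
      v                ≤⟨ v≤w ⟩
      w                ≡⟨ +-identityʳ w ⟨
      w + 0            ∎
      where open ≤-Reasoning
    w≡0 : w ≡ 0
    w≡0 = m+n≡0⇒m≡0 w (n≤0⇒n≡0 (+-cancelˡ-≤ w _ 0 [2+n]w≤w))

kernel-stable : ∀ {n} {X Y X' Y' : Tuple (2 + n)} → Kernel X Y → Step X Y X' Y' → ¬ Kernel X' Y'
kernel-stable (inj₁ b) s (inj₁ b') = balanced-step-¬balanced b s b'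
kernel-stable (inj₁ b) s (inj₂ b') = balanced-step-¬balanced-swap b s b'
kernel-stable (inj₂ b) s (inj₁ b') = balanced-step-¬balanced-swap b (step-swap s) b'
kernel-stable (inj₂ b) s (inj₂ b') = balanced-step-¬balanced b (step-swap s) b'

lowering-X : ∀ {n} {X Y X' : Tuple n} → X' ≤* X → Drops X' X → Step X Y X' Y
lowering-X X'≤X d = step X'≤X (λ _ → ≤-refl) (inj₁ d) (keeps-Y (λ _ → refl))

-- For c > 0, X is lowered to (c, 0, …, 0), which is balanced against Y the other way round.
absorb-constant-Y : ∀ {n c} (X Y : Tuple (3 + n)) → Constant c Y → (∀ i → c ≤ X i) → Absorbed X Y
absorb-constant-Y {c = c} X Y cY c≤X with c ≟ 0
... | yes refl with constant? 0 X
...   | yes cX = inj₁ (inj₁ (0 , cX , sum-zero cY , inj₂ refl))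
...   | no ¬cX = inj₂ (_ , Y , lowering-X (λ _ → z≤n) (drops-to-constant (λ _ → z≤n) ¬cX)
                      , inj₁ (0 , (λ _ → refl) , sum-zero cY , inj₂ refl))
absorb-constant-Y {n} {c} X Y cY c≤X | no c≢0 =
  inj₂ (X' , Y , lowering-X X'≤X (1F , ≤-trans (n≢0⇒n>0 c≢0) (c≤X 1F))
       , inj₂ (c , cY , sX' , inj₁ λ (_ , cX') → c≢0 (trans (cX' 0F) (sym (cX' 1F)))))
  where
  X' : Tuple (3 + n)
  X' 0F       = c
  X' (fsuc _) = 0
  X'≤X : X' ≤* X
  X'≤X 0F       = c≤X 0F
  X'≤X (fsuc _) = z≤n
  sX' : sum X' ≡ c
  sX' = trans (cong (c +_) (sum-zero {X = X' ∘ fsuc} (λ _ → refl))) (+-identityʳ c)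

absorb-nonconstant-Y : ∀ {n} (X Y : Tuple (3 + n)) {kX kY} → (∀ i → X kX ≤ X i) → Y kY ≤ X kX →
                       ¬ IsConstant Y → Absorbed X Y
absorb-nonconstant-Y X Y {kX} {kY} minX Y≤X ¬cY with sum Y ≤? X kX
... | yes sY≤X with constant? (sum Y) X
...   | yes cX  = inj₁ (inj₁ (sum Y , cX , refl , inj₁ ¬cY))
...   | no  ¬cX = inj₂ (_ , Y , lowering-X below (drops-to-constant below ¬cX)
                      , inj₁ (sum Y , (λ _ → refl) , refl , inj₁ ¬cY))
  where
  below : ∀ i → sum Y ≤ X i
  below i = ≤-trans sY≤X (minX i)
absorb-nonconstant-Y X Y {kX} {kY} minX Y≤X ¬cY | no sY≰X
  with interpolate-nonconstant Y kY ¬cY Y≤X (<⇒≤ (≰⇒> sY≰X))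
... | Y' , Y'≤Y , Y'k , sY' , nc =
  inj₂ (_ , Y' , step minX Y'≤Y (inj₂ (drops-of-sum< Y'≤Y (subst (_< sum Y) (sym sY') (≰⇒> sY≰X))))
                      (keeps-one-each (kX , refl) (kY , Y'k))
       , inj₁ (X kX , (λ _ → refl) , sY' , nc))

absorb-from-lower-min : ∀ {n} (X Y : Tuple (3 + n)) {kX kY} → (∀ i → X kX ≤ X i) → Y kY ≤ X kX → Absorbed X Y
absorb-from-lower-min X Y {kX} {kY} minX Y≤X with isConstant? Y
... | yes (c , cY) = absorb-constant-Y X Y cY (λ i → ≤-trans (≤-reflexive (sym (cY kY))) (≤-trans Y≤X (minX i)))
... | no  ¬cY      = absorb-nonconstant-Y X Y minX Y≤X ¬cY

kernel-absorbing : ∀ {n} (X Y : Tuple (3 + n)) → Absorbed X Y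
kernel-absorbing X Y with argmin X | argmin Y
... | kX , minX | kY , minY with ≤-total (Y kY) (X kX)
...   | inj₁ Y≤X = absorb-from-lower-min X Y {kX} {kY} minX Y≤X
...   | inj₂ X≤Y = absorbed-swap (absorb-from-lower-min Y X {kY} {kX} minY X≤Y)

module _ {n : ℕ} where

  infix 4 _∼_

  _∼_ : Tuple n → Tuple n → Set
  X ∼ X' = ∃[ π ] ∀ k → X k ≡ X' (π ⟨$⟩ʳ k)

  ∼-sym : ∀ {X X'} → X ∼ X' → X' ∼ X
  ∼-sym {X} {X'} (π , X≗) = Perm.flip π , λ k → trans (cong X' (sym (inverseʳ π))) (sym (X≗ (π ⟨$⟩ˡ k)))

  ≗⇒∼ : ∀ {X X'} → (∀ k → X k ≡ X' k) → X ∼ X'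
  ≗⇒∼ X≗ = Perm.id , X≗

  balanced-cong : ∀ {X X' Y Y'} → X ∼ X' → Y ∼ Y' → Balanced X Y → Balanced X' Y'
  balanced-cong {X} {X'} {Y} {Y'} (π , X≗) (τ , Y≗) (v , cX , sY , ncY) = v , cX' , sY' , ncY'
    where
    cX' : Constant v X'
    cX' k = trans (cong X' (sym (inverseʳ π))) (trans (sym (X≗ (π ⟨$⟩ˡ k))) (cX _))
    sY' : sum Y' ≡ v
    sY' = trans (sum-permute Y' τ) (trans (sym (sum-cong-≗ Y≗)) sY)
    ncY' : ¬ IsConstant Y' ⊎ v ≡ 0
    ncY' = [ (λ ¬cY → inj₁ λ (c , cY') → ¬cY (c , λ k → trans (Y≗ k) (cY' _))) , inj₂ ]′ ncY

  kernel-cong : ∀ {X X' Y Y'} → X ∼ X' → Y ∼ Y' → Kernel X Y → Kernel X' Y'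
  kernel-cong X∼ Y∼ = [ inj₁ ∘ balanced-cong X∼ Y∼ , inj₂ ∘ balanced-cong Y∼ X∼ ]′

-- Extended circular nim on eight piles

S : List ℕ
S = 1 ∷ 2 ∷ 3 ∷ []

ECN : Position 8 → Position 8 → Set
ECN = ECNMove 8 S 6

evenPile oddPile : Fin 4 → Fin 8
evenPile 0F = 0F
evenPile 1F = 2F
evenPile 2F = 4F
evenPile 3F = 6F
oddPile 0F = 1F
oddPile 1F = 3F
oddPile 2F = 5F
oddPile 3F = 7F

evens odds : Position 8 → Tuple 4
evens M = M ∘ evenPile
odds  M = M ∘ oddPile

interleave : Tuple 4 → Tuple 4 → Position 8
interleave X Y 0F = X 0F
interleave X Y 1F = Y 0F
interleave X Y 2F = X 1F
interleave X Y 3F = Y 1F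
interleave X Y 4F = X 2F
interleave X Y 5F = Y 2F
interleave X Y 6F = X 3F
interleave X Y 7F = Y 3F

interleave-even : ∀ X Y k → interleave X Y (evenPile k) ≡ X k
interleave-even X Y 0F = refl
interleave-even X Y 1F = refl
interleave-even X Y 2F = refl
interleave-even X Y 3F = refl

interleave-odd : ∀ X Y k → interleave X Y (oddPile k) ≡ Y k
interleave-odd X Y 0F = refl
interleave-odd X Y 1F = refl
interleave-odd X Y 2F = refl
interleave-odd X Y 3F = refl

data PileView : Fin 8 → Set where
  even : ∀ k → PileView (evenPile k)
  odd  : ∀ k → PileView (oddPile k)

pileView : ∀ p → PileView p
pileView 0F = even 0F
pileView 1F = odd 0F
pileView 2F = even 1F
pileView 3F = odd 1F
pileView 4F = even 2F
pileView 5F = odd 2F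
pileView 6F = even 3F
pileView 7F = odd 3F

affected? : ∀ s i j p → Dec (Affected 8 s i j p)
affected? s i j p = map′ (λ (t , t<1+j , e) → t , s≤s⁻¹ t<1+j , e) (λ (t , t≤j , e) → t , s≤s t≤j , e)
                         (anyUpTo? (λ t → pileIdx 8 (toℕ i + t * s) ≟ᶠ p) (suc j))

-- Every move is dominated by the one with j = 5, so it suffices to know the piles that one leaves alone.
Spared : ℕ → Fin 8 → Fin 8 → Set
Spared s i p = ¬ Affected 8 s i 5 p

spared? : ∀ s i p → Dec (Spared s i p)
spared? s i p = ¬? (affected? s i 5 p)

spared-untouched : ∀ {s i j p} → j < 6 → Spared s i p → ¬ Affected 8 s i j p
spared-untouched j<6 sp (t , t≤j , e) = sp (t , ≤-trans t≤j (s≤s⁻¹ j<6) , e)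

SparedPattern : ℕ → Fin 8 → Set
SparedPattern s i = (∀ k → Spared s i (oddPile k)) ⊎ (∀ k → Spared s i (evenPile k))
                  ⊎ (∃[ k ] Spared s i (evenPile k)) × (∃[ l ] Spared s i (oddPile l))

opaque
  -- s = 2 reaches a whole parity class; s = 1 and s = 3 spare piles i + 6, i + 7 and i + 2, i + 5.
  spared-pattern : ∀ {s} → s ∈ S → ∀ i → SparedPattern s i
  spared-pattern = All.lookup (toWitness {a? = All.all? pattern? S} tt)
    where
    pattern? : ∀ s → Dec (∀ i → SparedPattern s i)
    pattern? s = all? λ i → all? (spared? s i ∘ oddPile) ⊎-dec all? (spared? s i ∘ evenPile)
                            ⊎-dec any? (spared? s i ∘ evenPile) ×-dec any? (spared? s i ∘ oddPile)

  evens-sparing-move : ∀ p → Spared 2 1F p → ∃[ k ] p ≡ evenPile k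
  evens-sparing-move = toWitness {a? = all? λ p → spared? 2 1F p →-dec any? (λ k → p ≟ᶠ evenPile k)} tt

  odds-sparing-move : ∀ p → Spared 2 0F p → ∃[ k ] p ≡ oddPile k
  odds-sparing-move = toWitness {a? = all? λ p → spared? 2 0F p →-dec any? (λ k → p ≟ᶠ oddPile k)} tt

  -- An even and an odd pile lie at circular distance 1 or 3, which is what s = 1 or s = 3 spares.
  pair-sparing-move : ∀ k l → ∃[ s ] s ∈ S × ∃[ i ] ∀ p → Spared s i p → p ≡ evenPile k ⊎ p ≡ oddPile l
  pair-sparing-move k l = find (toWitness {a? = all? λ k → all? λ l → Any.any? (sparing? k l) S} tt k l)
    where
    sparing? : ∀ k l s → Dec (∃[ i ] ∀ p → Spared s i p → p ≡ evenPile k ⊎ p ≡ oddPile l)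
    sparing? k l s = any? λ i → all? λ p → spared? s i p →-dec (p ≟ᶠ evenPile k ⊎-dec p ≟ᶠ oddPile l)

ecn⇒step : ∀ {M M'} → ECN M M' → Step (evens M) (odds M) (evens M') (odds M')
ecn⇒step {M} {M'} (s , s∈S , i , j , j<6 , M'≤M , untouched , p , M'p<Mp) =
  step (M'≤M ∘ evenPile) (M'≤M ∘ oddPile) (drops (pileView p) M'p<Mp) keeps
  where
  kept : ∀ {q} → Spared s i q → M' q ≡ M q
  kept sp = untouched _ (spared-untouched {s} {i} j<6 sp)
  drops : ∀ {p} → PileView p → M' p < M p → Drops (evens M') (evens M) ⊎ Drops (odds M') (odds M)
  drops (even k) lt = inj₁ (k , lt)
  drops (odd k)  lt = inj₂ (k , lt)
  keeps : Keeps (evens M) (odds M) (evens M') (odds M')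
  keeps with spared-pattern s∈S i
  ... | inj₁ odds-spared                  = keeps-Y (kept ∘ odds-spared)
  ... | inj₂ (inj₁ evens-spared)          = keeps-X (kept ∘ evens-spared)
  ... | inj₂ (inj₂ ((k , sk) , (l , sl))) = keeps-one-each (k , kept sk) (l , kept sl)

module _ {M : Position 8} {X' Y' : Tuple 4} where

  private
    M' : Position 8
    M' = interleave X' Y'

  agrees-even : ∀ {p k} → X' k ≡ M (evenPile k) → p ≡ evenPile k → M' p ≡ M p
  agrees-even {k = k} e refl = trans (interleave-even X' Y' k) e

  agrees-odd : ∀ {p l} → Y' l ≡ M (oddPile l) → p ≡ oddPile l → M' p ≡ M p
  agrees-odd {l = l} e refl = trans (interleave-odd X' Y' l) e

  sparing-move : Keeps (evens M) (odds M) X' Y' → ∃[ s ] s ∈ S × ∃[ i ] ∀ p → Spared s i p → M' p ≡ M p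
  sparing-move (keeps-X e) =
    2 , there (here refl) , 1F , λ p sp → let k , p≡ = evens-sparing-move p sp in agrees-even (e k) p≡
  sparing-move (keeps-Y e) =
    2 , there (here refl) , 0F , λ p sp → let l , p≡ = odds-sparing-move p sp in agrees-odd (e l) p≡
  sparing-move (keeps-one-each (k , ek) (l , el)) with pair-sparing-move k l
  ... | s , s∈S , i , spares = s , s∈S , i , λ p sp → [ agrees-even ek , agrees-odd el ]′ (spares p sp)

  step⇒ecn : Step (evens M) (odds M) X' Y' → ECN M M'
  step⇒ecn (step X'≤X Y'≤Y drops keeps) with sparing-move keeps
  ... | s , s∈S , i , kept = s , s∈S , i , 5 , ≤-refl , M'≤M , kept , strict drops
    where
    M'≤M : ∀ p → M' p ≤ M p
    M'≤M p with pileView p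
    ... | even k = subst (_≤ M (evenPile k)) (sym (interleave-even X' Y' k)) (X'≤X k)
    ... | odd l  = subst (_≤ M (oddPile l)) (sym (interleave-odd X' Y' l)) (Y'≤Y l)
    strict : Drops X' (evens M) ⊎ Drops Y' (odds M) → ∃[ p ] M' p < M p
    strict (inj₁ (k , lt)) = evenPile k , subst (_< M (evenPile k)) (sym (interleave-even X' Y' k)) lt
    strict (inj₂ (l , lt)) = oddPile l , subst (_< M (oddPile l)) (sym (interleave-odd X' Y' l)) lt

InKernel : Position 8 → Set
InKernel M = Kernel (evens M) (odds M)

ecn-wellFounded : WellFounded (flip ECN)
ecn-wellFounded = Subrelation.wellFounded (λ (_ , _ , _ , _ , _ , M'≤M , _ , drop) → sum-mono-< M'≤M drop)
                                          (On.wellFounded sum <-wellFounded)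

ecn-stable : ∀ {M M'} → ECN M M' → InKernel M → ¬ InKernel M'
ecn-stable mv k = kernel-stable k (ecn⇒step mv)

ecn-absorbing : ∀ M → InKernel M ⊎ ∃[ M' ] ECN M M' × InKernel M'
ecn-absorbing M with kernel-absorbing (evens M) (odds M)
... | inj₁ k                  = inj₁ k
... | inj₂ (X' , Y' , s , k) = inj₂ (interleave X' Y' , step⇒ecn s , kernel-cong X'∼ Y'∼ k)
  where
  X'∼ : X' ∼ evens (interleave X' Y')
  X'∼ = ≗⇒∼ (sym ∘ interleave-even X' Y')
  Y'∼ : Y' ∼ odds (interleave X' Y')
  Y'∼ = ≗⇒∼ (sym ∘ interleave-odd X' Y')

isPPosition⇔inKernel : ∀ M → IsPPosition 8 S 6 M ⇔ InKernel M
isPPosition⇔inKernel = lose⇔kernel ecn-wellFounded ecn-stable ecn-absorbing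
  where open KernelCharacterisation ECN

-- Circular membership in P

odd-sum : ∀ (N : Position 8) → sum (odds N) ≡ N 1F + N 3F + N 5F + N 7F
odd-sum N = lemma (N 1F) (N 3F) (N 5F) (N 7F)
  where
  lemma : ∀ a b c d → a + (b + (c + (d + 0))) ≡ a + b + c + d
  lemma = solve-∀

setP⇒balanced : ∀ {N} → SetP N → Balanced (evens N) (odds N)
setP⇒balanced {N} (inj₁ ((e02 , e24 , e46 , e6s) , ¬B)) = N 6F , cE , trans (odd-sum N) (sym e6s) , inj₁ ¬cO
  where
  cE : Constant (N 6F) (evens N)
  cE 0F = trans e02 (trans e24 e46)
  cE 1F = trans e24 e46
  cE 2F = e46
  cE 3F = refl
  ¬cO : ¬ IsConstant (odds N)
  ¬cO (c , cO) = ¬B ((e02 , e24 , e46) ,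
                     trans (cO 0F) (sym (cO 1F)) , trans (cO 1F) (sym (cO 2F)) , trans (cO 2F) (sym (cO 3F)))
setP⇒balanced (inj₂ all-zero) = 0 , all-zero ∘ evenPile , sum-zero (all-zero ∘ oddPile) , inj₂ refl

balanced⇒setP : ∀ {N} → Balanced (evens N) (odds N) → SetP N
balanced⇒setP {N} (v , cE , sO , inj₁ ¬cO) =
  inj₁ ( (trans (cE 0F) (sym (cE 1F)) , trans (cE 1F) (sym (cE 2F)) , trans (cE 2F) (sym (cE 3F))
         , trans (cE 3F) (trans (sym sO) (odd-sum N)))
       , λ (_ , e13 , e35 , e57) → ¬cO (N 7F , cO e13 e35 e57))
  where
  cO : N 1F ≡ N 3F → N 3F ≡ N 5F → N 5F ≡ N 7F → Constant (N 7F) (odds N)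
  cO e13 e35 e57 0F = trans e13 (trans e35 e57)
  cO e13 e35 e57 1F = trans e35 e57
  cO e13 e35 e57 2F = e57
  cO e13 e35 e57 3F = refl
balanced⇒setP {N} (v , cE , sO , inj₂ refl) = inj₂ all-zero
  where
  all-zero : ∀ p → N p ≡ 0
  all-zero p with pileView p
  ... | even k = cE k
  ... | odd l  = sum≡0⇒≡0 {X = odds N} sO l

-- M ∈↻ P unfolds to P (M ∘ rotate i) ⊎ P (M ∘ reflect i) for some i.
rotate reflect : Fin 8 → Fin 8 → Fin 8
rotate  i r = pileIdx 8 (toℕ i + toℕ r)
reflect i r = pileIdx 8 (toℕ i + (8 ∸ toℕ r))

-- The symmetries of a square, acting on the four piles of a parity class; ρ is k ↦ k + 1.
D₄ : List (Permutation 4 4)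
D₄ = Perm.id ∷ ρ ∷ ρ ∘ₚ ρ ∷ ρ ∘ₚ ρ ∘ₚ ρ
   ∷ ν ∷ ν ∘ₚ ρ ∷ ν ∘ₚ ρ ∘ₚ ρ ∷ ν ∘ₚ ρ ∘ₚ ρ ∘ₚ ρ ∷ []
  where
  ν ρ : Permutation 4 4
  ν = transpose 1F 3F
  ρ = reverse ∘ₚ ν

infix 4 _↝_

record _↝_ (f f' : Fin 4 → Fin 8) : Set where
  constructor via
  field
    symmetry : Any (λ π → ∀ k → f k ≡ f' (π ⟨$⟩ʳ k)) D₄

relabel : ∀ {f f'} (M : Position 8) → f ↝ f' → M ∘ f ∼ M ∘ f'
relabel M (via r) = let π , f≗ = satisfied r in π , cong M ∘ f≗

Preserves Exchanges : (Fin 8 → Fin 8) → Set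
Preserves g = (g ∘ evenPile ↝ evenPile) × (g ∘ oddPile ↝ oddPile)
Exchanges g = (g ∘ evenPile ↝ oddPile) × (g ∘ oddPile ↝ evenPile)

RespectsParity : (Fin 8 → Fin 8) → Set
RespectsParity g = Preserves g ⊎ Exchanges g

↝? : ∀ f f' → Dec (f ↝ f')
↝? f f' = map′ via _↝_.symmetry (Any.any? (λ π → all? λ k → f k ≟ᶠ f' (π ⟨$⟩ʳ k)) D₄)

preserves? : ∀ g → Dec (Preserves g)
preserves? g = ↝? (g ∘ evenPile) evenPile ×-dec ↝? (g ∘ oddPile) oddPile

exchanges? : ∀ g → Dec (Exchanges g)
exchanges? g = ↝? (g ∘ evenPile) oddPile ×-dec ↝? (g ∘ oddPile) evenPile

respectsParity? : ∀ g → Dec (RespectsParity g)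
respectsParity? g = preserves? g ⊎-dec exchanges? g

opaque
  symmetries-respect-parity : ∀ i → RespectsParity (rotate i) × RespectsParity (reflect i)
  symmetries-respect-parity = toWitness {a? = all? λ i → respectsParity? (rotate i) ×-dec respectsParity? (reflect i)} tt

  rotate-0-preserves : Preserves (rotate 0F)
  rotate-0-preserves = toWitness {a? = preserves? (rotate 0F)} tt

  rotate-1-exchanges : Exchanges (rotate 1F)
  rotate-1-exchanges = toWitness {a? = exchanges? (rotate 1F)} tt

inKernel-of-view : ∀ M g → RespectsParity g → Balanced (evens (M ∘ g)) (odds (M ∘ g)) → InKernel M
inKernel-of-view M _ (inj₁ (e , o)) = inj₁ ∘ balanced-cong (relabel M e) (relabel M o)
inKernel-of-view M _ (inj₂ (e , o)) = inj₂ ∘ balanced-cong (relabel M e) (relabel M o)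

inKernel⇔circular : ∀ M → InKernel M ⇔ M ∈↻ SetP
inKernel⇔circular M = mk⇔ to from
  where
  to : InKernel M → M ∈↻ SetP
  to (inj₁ b) with rotate-0-preserves
  ... | e , o = 0F , inj₁ (balanced⇒setP (balanced-cong (∼-sym (relabel M e)) (∼-sym (relabel M o)) b))
  to (inj₂ b) with rotate-1-exchanges
  ... | e , o = 1F , inj₁ (balanced⇒setP (balanced-cong (∼-sym (relabel M e)) (∼-sym (relabel M o)) b))
  from : M ∈↻ SetP → InKernel M
  from (i , inj₁ p) = inKernel-of-view M (rotate i) (proj₁ (symmetries-respect-parity i)) (setP⇒balanced p)
  from (i , inj₂ p) = inKernel-of-view M (reflect i) (proj₂ (symmetries-respect-parity i)) (setP⇒balanced p)

mainTheorem12 : (M : Position 8) → IsPPosition 8 (1 ∷ 2 ∷ 3 ∷ []) 6 M ⇔ (M ∈↻ SetP)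
mainTheorem12 M = ⇔-trans (isPPosition⇔inKernel M) (inKernel⇔circular M)
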